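{- If $\mathcal C$ is an infinite almost disjoint family of functions from $\omega$ to $\omega$ (each function regarded as a subset of $\omega\times\omega$), then $\bigcup\mathcal C$ is fat.
   Context: A set $F\subseteq\omega\times\omega$ is fat iff $\limsup_n|\pi_nF|=\omega$, where $\pi_nF=\{j:(n,j)\in F\}$. Almost disjoint means pairwise intersections (as subsets of $\omega\times\omega$) are finite. -}

module Defs where

open import Data.Nat using (ℕ; _<_; _≤_)
open import Data.Product using (_×_; _,_; Σ; ∃; proj₁; proj₂)
open import Data.List using (List; length)
open import Data.List.Relation.Unary.All using (All)
open import Data.List.Relation.Unary.Unique.Propositional using (Unique)
open import Relation.Binary.PropositionalEquality using (_≡_; _≗_)
open import Relation.Nullary using (¬_)

SubsetΩ² : Set₁
SubsetΩ² = ℕ × ℕ → Set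

Family : Set₁
Family = (ℕ → ℕ) → Set

graph : (ℕ → ℕ) → SubsetΩ²
graph f (n , j) = f n ≡ j

_∩_ : SubsetΩ² → SubsetΩ² → SubsetΩ²
(A ∩ B) p = A p × B p

⋃ : Family → SubsetΩ²
⋃ C p = Σ (ℕ → ℕ) λ f → C f × graph f p

π : ℕ → SubsetΩ² → ℕ → Set
π n F j = F (n , j)

FiniteΩ² : SubsetΩ² → Set
FiniteΩ² A = ∃ λ N → ∀ p → A p → proj₁ p < N × proj₂ p < N

AtLeast : ℕ → (ℕ → Set) → Set
AtLeast k A = Σ (List ℕ) λ xs → length xs ≡ k × Unique xs × All A xs

-- F is fat iff limsup_n |π_n F| = ω, i.e. for every k there are
-- infinitely many n with |π_n F| ≥ k.
Fat : SubsetΩ² → Set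
Fat F = ∀ k m → ∃ λ n → m ≤ n × AtLeast k (π n F)

AlmostDisjoint : Family → Set
AlmostDisjoint C = ∀ f g → C f → C g → ¬ (f ≗ g) → FiniteΩ² (graph f ∩ graph g)

Infinite : Family → Set
Infinite C = ∀ (gs : List (ℕ → ℕ)) → All C gs →
  Σ (ℕ → ℕ) λ f → C f × All (λ g → ¬ (f ≗ g)) gs

-- Pick k pairwise distinct members of 𝒞. Any two of them agree only at
-- finitely many arguments, so beyond some N their values at each n are k
-- distinct elements of π_n ⋃ 𝒞; this holds for every n ≥ N, in particular
-- for infinitely many n.
module Submission where

open import Defs
open import Data.Nat using (ℕ; zero; suc; _≤_; _⊔_)
open import Data.Nat.Properties using (m≤m⊔n; m≤n⊔m; ≤-trans; <⇒≱)
open import Data.Product using (_×_; _,_; Σ; ∃; proj₁)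
open import Data.List using (List; []; _∷_; length; map)
open import Data.List.Properties using (length-map)
open import Data.List.Relation.Unary.All as All using (All; []; _∷_)
import Data.List.Relation.Unary.All.Properties as All
open import Data.List.Relation.Unary.AllPairs using (AllPairs; []; _∷_)
import Data.List.Relation.Unary.AllPairs.Properties as AllPairs
open import Relation.Binary.PropositionalEquality using (_≡_; _≢_; _≗_; refl; sym; trans)
open import Relation.Nullary using (¬_)

Eventually : (ℕ → Set) → Set
Eventually P = ∃ λ N → ∀ n → N ≤ n → P n

eventually-× : {P Q : ℕ → Set} → Eventually P → Eventually Q →
  Eventually (λ n → P n × Q n)
eventually-× (M , pM) (N , qN) = M ⊔ N , λ n M⊔N≤n →
  pM n (≤-trans (m≤m⊔n M N) M⊔N≤n) , qN n (≤-trans (m≤n⊔m M N) M⊔N≤n)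

eventually-All : {A : Set} {P : A → ℕ → Set} {xs : List A} →
  All (λ x → Eventually (P x)) xs → Eventually (λ n → All (λ x → P x n) xs)
eventually-All []         = 0 , λ _ _ → []
eventually-All (px ∷ pxs) with eventually-× px (eventually-All pxs)
... | N , both = N , λ n N≤n → let p , ps = both n N≤n in p ∷ ps

eventually-AllPairs : {A : Set} {R : A → A → ℕ → Set} {xs : List A} →
  AllPairs (λ x y → Eventually (R x y)) xs →
  Eventually (λ n → AllPairs (λ x y → R x y n) xs)
eventually-AllPairs []           = 0 , λ _ _ → []
eventually-AllPairs (rx ∷ rxs) with eventually-× (eventually-All rx) (eventually-AllPairs rxs)
... | N , both = N , λ n N≤n → let r , rs = both n N≤n in r ∷ rs

finite-graph-∩⇒eventually-≢ : (f g : ℕ → ℕ) → FiniteΩ² (graph f ∩ graph g) →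
  Eventually (λ n → f n ≢ g n)
finite-graph-∩⇒eventually-≢ f g (N , bounded) = N , λ n N≤n fn≡gn →
  <⇒≱ (proj₁ (bounded (n , f n) (refl , sym fn≡gn))) N≤n

infinite⇒distinct-members : (C : Family) → Infinite C → (k : ℕ) →
  Σ (List (ℕ → ℕ)) λ gs → length gs ≡ k × All C gs × AllPairs (λ f g → ¬ (f ≗ g)) gs
infinite⇒distinct-members C inf zero = [] , refl , [] , []
infinite⇒distinct-members C inf (suc k) with infinite⇒distinct-members C inf k
... | gs , refl , Cgs , distinct with inf gs Cgs
... | f , Cf , f-new = f ∷ gs , refl , Cf ∷ Cgs , f-new ∷ distinct

eventually-distinct-values : (C : Family) → AlmostDisjoint C → {gs : List (ℕ → ℕ)} →
  All C gs → AllPairs (λ f g → ¬ (f ≗ g)) gs →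
  Eventually (λ n → AllPairs (λ f g → f n ≢ g n) gs)
eventually-distinct-values C ad Cgs distinct = eventually-AllPairs (pairwise Cgs distinct)
  where
  pairwise : ∀ {gs} → All C gs → AllPairs (λ f g → ¬ (f ≗ g)) gs →
    AllPairs (λ f g → Eventually (λ n → f n ≢ g n)) gs
  pairwise []         []               = []
  pairwise (Cf ∷ Cgs) (f≉gs ∷ distinct) =
    All.zipWith (λ { (Cg , f≉g) → finite-graph-∩⇒eventually-≢ _ _ (ad _ _ Cf Cg f≉g) })
                (Cgs , f≉gs)
    ∷ pairwise Cgs distinct

values-in-⋃ : (C : Family) (n : ℕ) {gs : List (ℕ → ℕ)} →
  All C gs → All (π n (⋃ C)) (map (λ g → g n) gs)
values-in-⋃ C n Cgs = All.map⁺ (All.map (λ {g} Cg → g , Cg , refl) Cgs)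

lemma2p2 : (C : Family) → Infinite C → AlmostDisjoint C → Fat (⋃ C)
lemma2p2 C inf ad k m
  with gs , length≡k , Cgs , distinct ← infinite⇒distinct-members C inf k
  with N , injective-from-N ← eventually-distinct-values C ad Cgs distinct
  = m ⊔ N , m≤m⊔n m N , map (λ g → g (m ⊔ N)) gs
  , trans (length-map _ gs) length≡k
  , AllPairs.map⁺ (injective-from-N (m ⊔ N) (m≤n⊔m m N))
  , values-in-⋃ C (m ⊔ N) Cgs
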